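{- Let $S(n)$ be the set of $n$-tuples $(x_1,\ldots,x_n)$ of positive integers with $x_1\leq\cdots\leq x_n$ and $\sigma_2(x_1,\ldots,x_n)=\sigma_n(x_1,\ldots,x_n)$. Then $$\limsup_{n\to+\infty}\ \max_{(x_1,\ldots,x_n)\in S(n)}\frac{x_n}{x_{n-1}}=+\infty.$$
   Context: $\sigma_k$ denotes the $k$-th elementary symmetric polynomial in $n$ variables. -}

module Defs where

open import Data.Nat using (ℕ; zero; suc; _+_; _*_; _≤_; _<_)
open import Data.Fin using (Fin; fromℕ; inject₁)
open import Data.Vec using (Vec; []; _∷_; lookup)
open import Data.Product using (_×_)
open import Relation.Binary.PropositionalEquality using (_≡_)

σ : ∀ {n} → ℕ → Vec ℕ n → ℕ
σ zero    _        = 1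
σ (suc k) []       = 0
σ (suc k) (x ∷ xs) = x * σ k xs + σ (suc k) xs

Positive : ∀ {n} → Vec ℕ n → Set
Positive {n} x = (i : Fin n) → 0 < lookup x i

NonDecreasing : ∀ {n} → Vec ℕ n → Set
NonDecreasing {n} x = (i j : Fin n) → Data.Fin._≤_ i j → lookup x i ≤ lookup x j

InS : (n : ℕ) → Vec ℕ n → Set
InS n x = Positive x × NonDecreasing x × σ 2 x ≡ σ n x

lastE : ∀ {k} → Vec ℕ (suc (suc k)) → ℕ
lastE {k} x = lookup x (fromℕ (suc k))

penultE : ∀ {k} → Vec ℕ (suc (suc k)) → ℕ
penultE {k} x = lookup x (inject₁ (fromℕ k))

{-# OPTIONS --safe #-}
-- The tuples are (1, …, 1, 2, a, b) with m ones, for which σₙ = 2ab. Expanding σ₂ over the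
-- ones turns σ₂ = σₙ into (a − (m+2))(b − (m+2)) = C(m,2) + 2m + (m+2)², so a = m + 3
-- forces b = (m+2)(m+3) + 2m + C(m,2), and b/a ≥ m + 2 grows without bound.
module Submission where

open import Defs
open import Data.Nat using (ℕ; zero; suc; _+_; _*_; _≤_; _<_; z≤n; s≤s)
open import Data.Nat.Properties
open import Data.Nat.Combinatorics using (_C_; nC1≡n; nCk+nC[k+1]≡[n+1]C[k+1])
open import Data.Nat.Tactic.RingSolver using (solve; solve-∀)
import Data.Fin.Properties as Finₚ
open import Data.Vec using (Vec; []; _∷_)
import Data.List as List
open import Data.Vec.Relation.Unary.All using (All; []; _∷_)
open import Data.Vec.Relation.Unary.All.Properties using (lookup⁺)
open import Data.Vec.Relation.Unary.Linked using (Linked; [-]; _∷_)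
import Data.Vec.Relation.Unary.Linked.Properties as Linked
open import Data.Product using (_×_; _,_; Σ; ∃-syntax)
open import Relation.Nullary using (yes; no)
open import Relation.Binary.PropositionalEquality
  using (_≡_; refl; sym; trans; cong; cong₂; subst₂; module ≡-Reasoning)

linked⇒nonDecreasing : ∀ {n} {xs : Vec ℕ n} → Linked _≤_ xs → NonDecreasing xs
linked⇒nonDecreasing l i j i≤j with i Finₚ.≟ j
... | yes refl = ≤-refl
... | no  i≢j  = Linked.lookup⁺ ≤-trans l (Finₚ.≤∧≢⇒< i≤j i≢j)

σ-suc-vanishes : ∀ {n} k (xs : Vec ℕ n) → n ≤ k → σ (suc k) xs ≡ 0
σ-suc-vanishes k       []       _         = refl
σ-suc-vanishes (suc k) (x ∷ xs) (s≤s n≤k) =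
  cong₂ _+_ (trans (cong (x *_) (σ-suc-vanishes k xs n≤k)) (*-zeroʳ x))
            (σ-suc-vanishes (suc k) xs (m≤n⇒m≤1+n n≤k))

σ-suc-1∷ : ∀ {n} k (xs : Vec ℕ n) → σ (suc k) (1 ∷ xs) ≡ σ k xs + σ (suc k) xs
σ-suc-1∷ k xs = cong (_+ σ (suc k) xs) (*-identityˡ (σ k xs))

σ-top-1∷ : ∀ {n} (xs : Vec ℕ n) → σ (suc n) (1 ∷ xs) ≡ σ n xs
σ-top-1∷ {n} xs = begin
  σ (suc n) (1 ∷ xs)       ≡⟨ σ-suc-1∷ n xs ⟩
  σ n xs + σ (suc n) xs    ≡⟨ cong (σ n xs +_) (σ-suc-vanishes n xs ≤-refl) ⟩
  σ n xs + 0               ≡⟨ +-identityʳ (σ n xs) ⟩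
  σ n xs                   ∎
  where open ≡-Reasoning

module _ (x y z : ℕ) where
  open ≡-Reasoning

  σ₁-triple : σ 1 (x ∷ y ∷ z ∷ []) ≡ x + y + z
  σ₁-triple = begin
    σ 1 (x ∷ y ∷ z ∷ [])           ≡⟨⟩
    x * 1 + (y * 1 + (z * 1 + 0))  ≡⟨ solve (x List.∷ y List.∷ z List.∷ List.[]) ⟩
    x + y + z                      ∎

  σ₂-triple : σ 2 (x ∷ y ∷ z ∷ []) ≡ x * y + x * z + y * z
  σ₂-triple = begin
    σ 2 (x ∷ y ∷ z ∷ [])                                         ≡⟨⟩
    x * (y * 1 + (z * 1 + 0)) + (y * (z * 1 + 0) + (z * 0 + 0))  ≡⟨ solve (x List.∷ y List.∷ z List.∷ List.[]) ⟩
    x * y + x * z + y * z                                        ∎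

  σ₃-triple : σ 3 (x ∷ y ∷ z ∷ []) ≡ x * y * z
  σ₃-triple = begin
    σ 3 (x ∷ y ∷ z ∷ [])                                                   ≡⟨⟩
    x * (y * (z * 1 + 0) + (z * 0 + 0)) + (y * (z * 0 + 0) + (z * 0 + 0))  ≡⟨ solve (x List.∷ y List.∷ z List.∷ List.[]) ⟩
    x * y * z                                                              ∎

onesThen2 : (m a b : ℕ) → Vec ℕ (3 + m)
onesThen2 zero    a b = 2 ∷ a ∷ b ∷ []
onesThen2 (suc m) a b = 1 ∷ onesThen2 m a b

module _ (a b : ℕ) where

  σ-top-onesThen2 : ∀ m → σ (3 + m) (onesThen2 m a b) ≡ 2 * a * b
  σ-top-onesThen2 zero    = σ₃-triple 2 a b
  σ-top-onesThen2 (suc m) = trans (σ-top-1∷ (onesThen2 m a b)) (σ-top-onesThen2 m)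

  σ₁-onesThen2 : ∀ m → σ 1 (onesThen2 m a b) ≡ m + (2 + a + b)
  σ₁-onesThen2 zero    = σ₁-triple 2 a b
  σ₁-onesThen2 (suc m) = cong suc (σ₁-onesThen2 m)

  σ₂-onesThen2 : ∀ m →
    σ 2 (onesThen2 m a b) ≡ m C 2 + m * (2 + a + b) + (2 * a + 2 * b + a * b)
  σ₂-onesThen2 zero    = σ₂-triple 2 a b
  σ₂-onesThen2 (suc m) = begin
    σ 2 (1 ∷ onesThen2 m a b)
      ≡⟨ σ-suc-1∷ 1 (onesThen2 m a b) ⟩
    σ 1 (onesThen2 m a b) + σ 2 (onesThen2 m a b)
      ≡⟨ cong₂ _+_ (σ₁-onesThen2 m) (σ₂-onesThen2 m) ⟩
    m + s + (m C 2 + m * s + c)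
      ≡⟨ regroup m (m C 2) s c ⟩
    (m + m C 2) + suc m * s + c
      ≡⟨ cong (λ t → t + suc m * s + c) pascal ⟩
    suc m C 2 + suc m * s + c
      ∎
    where
    open ≡-Reasoning
    s c : ℕ
    s = 2 + a + b
    c = 2 * a + 2 * b + a * b
    regroup : ∀ m t s c → m + s + (t + m * s + c) ≡ (m + t) + suc m * s + c
    regroup = solve-∀
    pascal : m + m C 2 ≡ suc m C 2
    pascal = trans (cong (_+ m C 2) (sym (nC1≡n m))) (nCk+nC[k+1]≡[n+1]C[k+1] m 1)

  linked-onesThen2 : 2 ≤ a → a ≤ b → ∀ m → Linked _≤_ (onesThen2 m a b)
  linked-onesThen2 2≤a a≤b zero          = 2≤a ∷ a≤b ∷ [-]
  linked-onesThen2 2≤a a≤b (suc zero)    = s≤s z≤n ∷ linked-onesThen2 2≤a a≤b zero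
  linked-onesThen2 2≤a a≤b (suc (suc m)) = ≤-refl ∷ linked-onesThen2 2≤a a≤b (suc m)

  positive-onesThen2 : 0 < a → 0 < b → ∀ m → All (0 <_) (onesThen2 m a b)
  positive-onesThen2 0<a 0<b zero    = s≤s z≤n ∷ 0<a ∷ 0<b ∷ []
  positive-onesThen2 0<a 0<b (suc m) = s≤s z≤n ∷ positive-onesThen2 0<a 0<b m

  last-onesThen2 : ∀ m → lastE (onesThen2 m a b) ≡ b
  last-onesThen2 zero    = refl
  last-onesThen2 (suc m) = last-onesThen2 m

  penult-onesThen2 : ∀ m → penultE (onesThen2 m a b) ≡ a
  penult-onesThen2 zero    = refl
  penult-onesThen2 (suc m) = penult-onesThen2 m

smallEntry bigEntry : ℕ → ℕ
smallEntry m = 3 + m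
bigEntry   m = (2 + m) * smallEntry m + (2 * m + m C 2)

σ₂≡σₙ-onesThen2 : ∀ m →
  σ 2 (onesThen2 m (smallEntry m) (bigEntry m)) ≡ σ (3 + m) (onesThen2 m (smallEntry m) (bigEntry m))
σ₂≡σₙ-onesThen2 m = begin
  σ 2 (onesThen2 m a b)                                ≡⟨ σ₂-onesThen2 a b m ⟩
  m C 2 + m * (2 + a + b) + (2 * a + 2 * b + a * b)    ≡⟨ solves m (m C 2) ⟩
  2 * a * b                                            ≡⟨ sym (σ-top-onesThen2 a b m) ⟩
  σ (3 + m) (onesThen2 m a b)                          ∎
  where
  open ≡-Reasoning
  a b : ℕ
  a = smallEntry m
  b = bigEntry m
  solves : ∀ m t → let a = 3 + m; b = (2 + m) * a + (2 * m + t) in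
    t + m * (2 + a + b) + (2 * a + 2 * b + a * b) ≡ 2 * a * b
  solves = solve-∀

smallEntry≤bigEntry : ∀ m → smallEntry m ≤ bigEntry m
smallEntry≤bigEntry m =
  ≤-trans (m≤m+n (smallEntry m) _) (m≤m+n ((2 + m) * smallEntry m) _)

bigEntry-ratio : ∀ {M} m → M ≤ m → M * smallEntry m < bigEntry m
bigEntry-ratio {M} m M≤m = begin-strict
  M * a          ≤⟨ *-monoˡ-≤ a M≤m ⟩
  m * a          <⟨ *-monoˡ-< a (m<n+m m {2} (s≤s z≤n)) ⟩
  (2 + m) * a    ≤⟨ m≤m+n ((2 + m) * a) _ ⟩
  bigEntry m     ∎
  where
  open ≤-Reasoning
  a : ℕ
  a = smallEntry m

corollary2p15 : (M N : ℕ) →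
    ∃[ k ] (N ≤ suc (suc k) × Σ (Vec ℕ (suc (suc k))) (λ x →
    InS (suc (suc k)) x × M * penultE x < lastE x))
corollary2p15 M N =
  suc m , ≤-trans (m≤n+m N M) (m≤n+m m 3) , x ,
  ( lookup⁺ (positive-onesThen2 a b (s≤s z≤n) (≤-trans (s≤s z≤n) a≤b) m)
  , linked⇒nonDecreasing (linked-onesThen2 a b (s≤s (s≤s z≤n)) a≤b m)
  , σ₂≡σₙ-onesThen2 m )
  , subst₂ (λ u v → M * u < v) (sym (penult-onesThen2 a b m)) (sym (last-onesThen2 a b m))
           (bigEntry-ratio m (m≤m+n M N))
  where
  m a b : ℕ
  m = M + N
  a = smallEntry m
  b = bigEntry m
  a≤b : a ≤ b
  a≤b = smallEntry≤bigEntry m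
  x : Vec ℕ (3 + m)
  x = onesThen2 m a b
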